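{- Let $n>8$ and let $G$ be a divisible design graph with parameters $(4n,3n-2,3n-6,2n-2,4,n)$. Then there exist a divisible design graph $H$ with parameters $(4n,n+2,n-2,2,4,n)$ and a numbering $W_1,W_2,W_3,W_4$ of the classes of a canonical partition of $H$ for which the quotient matrix of $H$ equals one of $$\begin{pmatrix} n-1&1&1&1\\ 1&n-1&1&1\\ 1&1&n-1&1\\ 1&1&1&n-1\end{pmatrix},\quad \begin{pmatrix} 1&n-1&1&1\\ n-1&1&1&1\\ 1&1&n-1&1\\ 1&1&1&n-1\end{pmatrix},\quad \begin{pmatrix} 1&n-1&1&1\\ n-1&1&1&1\\ 1&1&1&n-1\\ 1&1&n-1&1\end{pmatrix},$$ such that $G$ is isomorphic to the graph obtained from $H$ by switching between the first two and the last two classes, i.e. by complementing every adjacency between a vertex of $W_1\cup W_2$ and a vertex of $W_3\cup W_4$ (all other adjacencies unchanged).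
   Context: A divisible design graph (DDG) with parameters $(v,k,\lambda_1,\lambda_2,m,n)$ is a $k$-regular graph on $v=mn$ vertices whose vertex set can be partitioned into $m$ classes of size $n$ (a canonical partition) such that any two distinct vertices in the same class have exactly $\lambda_1$ common neighbours and any two vertices in different classes have exactly $\lambda_2$ common neighbours. For a DDG with $\lambda_1\neq\lambda_2$ the canonical partition is equitable: each vertex of class $W_i$ has the same number $r_{ij}$ of neighbours in class $W_j$, and $(r_{ij})$ is the quotient matrix. -}

module Defs where

open import Data.Nat using (ℕ; zero; suc; _+_; _*_; _∸_)
open import Data.Bool using (Bool; true; false; _∧_; if_then_else_; not; _xor_)
open import Data.Fin using (Fin; zero; suc; _≟_)
open import Data.Vec using (Vec; []; _∷_; lookup)
open import Data.Product using (Σ; ∃; _×_; _,_)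
open import Relation.Nullary.Decidable using (⌊_⌋)
open import Relation.Binary.PropositionalEquality using (_≡_; _≢_)
open import Function.Bundles using (_↔_; Inverse)

record Graph (v : ℕ) : Set where
  field
    adj    : Fin v → Fin v → Bool
    adj-sym : ∀ x y → adj x y ≡ adj y x
    adj-irr : ∀ x → adj x x ≡ false
open Graph public

count : ∀ {v} → (Fin v → Bool) → ℕ
count {zero}  f = 0
count {suc v} f = (if f zero then 1 else 0) + count (λ x → f (suc x))

common : ∀ {v} → Graph v → Fin v → Fin v → ℕ
common G x y = count (λ w → adj G x w ∧ adj G y w)

degree : ∀ {v} → Graph v → Fin v → ℕ
degree G x = count (adj G x)

nbrsIn : ∀ {v m} → Graph v → (Fin v → Fin m) → Fin v → Fin m → ℕ
nbrsIn G p x j = count (λ y → adj G x y ∧ ⌊ p y ≟ j ⌋)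

-- p : Fin (m*n) → Fin m is a canonical partition of G into m classes of size n,
-- making G a divisible design graph with parameters (m*n, k, λ1, λ2, m, n).
record IsDDGPartition {m n : ℕ} (G : Graph (m * n)) (k λ1 λ2 : ℕ)
                      (p : Fin (m * n) → Fin m) : Set where
  field
    classSize : ∀ i → count (λ x → ⌊ p x ≟ i ⌋) ≡ n
    regular   : ∀ x → degree G x ≡ k
    sameClass : ∀ x y → x ≢ y → p x ≡ p y → common G x y ≡ λ1
    diffClass : ∀ x y → p x ≢ p y → common G x y ≡ λ2

IsDDG : {m n : ℕ} (G : Graph (m * n)) (k λ1 λ2 : ℕ) → Set
IsDDG {m} {n} G k λ1 λ2 = Σ (Fin (m * n) → Fin m) (λ p → IsDDGPartition G k λ1 λ2 p)

HasQuotient : ∀ {v m} → Graph v → (Fin v → Fin m) → (Fin m → Fin m → ℕ) → Set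
HasQuotient G p M = ∀ x j → nbrsIn G p x j ≡ M (p x) j

mat4 : Vec (Vec ℕ 4) 4 → Fin 4 → Fin 4 → ℕ
mat4 rows i j = lookup (lookup rows i) j

Q1 Q2 Q3 : ℕ → Fin 4 → Fin 4 → ℕ
Q1 n = mat4 ((n ∸ 1 ∷ 1 ∷ 1 ∷ 1 ∷ []) ∷ (1 ∷ n ∸ 1 ∷ 1 ∷ 1 ∷ []) ∷
             (1 ∷ 1 ∷ n ∸ 1 ∷ 1 ∷ []) ∷ (1 ∷ 1 ∷ 1 ∷ n ∸ 1 ∷ []) ∷ [])
Q2 n = mat4 ((1 ∷ n ∸ 1 ∷ 1 ∷ 1 ∷ []) ∷ (n ∸ 1 ∷ 1 ∷ 1 ∷ 1 ∷ []) ∷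
             (1 ∷ 1 ∷ n ∸ 1 ∷ 1 ∷ []) ∷ (1 ∷ 1 ∷ 1 ∷ n ∸ 1 ∷ []) ∷ [])
Q3 n = mat4 ((1 ∷ n ∸ 1 ∷ 1 ∷ 1 ∷ []) ∷ (n ∸ 1 ∷ 1 ∷ 1 ∷ 1 ∷ []) ∷
             (1 ∷ 1 ∷ 1 ∷ n ∸ 1 ∷ []) ∷ (1 ∷ 1 ∷ n ∸ 1 ∷ 1 ∷ []) ∷ [])

inFirstTwo : Fin 4 → Bool
inFirstTwo zero          = true
inFirstTwo (suc zero)    = true
inFirstTwo (suc (suc _)) = false

-- adjacency of the graph obtained from H by switching between W1 ∪ W2 and W3 ∪ W4
switchAdj : ∀ {v} → Graph v → (Fin v → Fin 4) → Fin v → Fin v → Bool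
switchAdj H p x y = (inFirstTwo (p x) xor inFirstTwo (p y)) xor adj H x y

IsoToAdj : ∀ {v} → Graph v → (Fin v → Fin v → Bool) → Set
IsoToAdj {v} G A = Σ (Fin v ↔ Fin v) (λ σ →
  ∀ x y → adj G x y ≡ A (Inverse.to σ x) (Inverse.to σ y))

{-# OPTIONS --safe #-}
-- Since λ₁ ≠ λ₂, counting walks of length three in two ways shows that the canonical partition of G
-- is equitable with a symmetric quotient matrix R.  A row of R sums to k = 3n − 2 and its squares sum
-- to λ₁(n − 1) + k; for n > 8 this forces the row to consist of one entry 1 and three entries n − 1,
-- so R is described by an involution c of the four classes (c i is the column of the 1 in row i).
-- Pair the classes into two halves so that every class i lies in the same half as c i, and switch G
-- between the halves.  Switching complements the entries of R between the halves, so the switched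
-- graph H has one entry n − 1 and three entries 1 in every row of its quotient matrix, and the
-- switching identities for common neighbours turn λ₁, λ₂ of G into n − 2 and 2.  For each of the ten
-- involutions, a pairing together with a numbering of the classes bringing the quotient matrix of H
-- into one of the three normal forms is found by a finite search.
module Submission where

open import Defs
open import Data.Bool using (Bool; true; false; not; _∧_; _xor_; if_then_else_; T)
open import Data.Bool.Properties as Bool using (xor-comm; xor-same; xor-assoc; not-distribˡ-xor)
open import Data.Fin using (Fin; zero; suc; _≟_; punchIn; punchOut)
open import Data.Fin.Properties using (any?; all?; punchIn-punchOut)
open import Data.List using (List; []; _∷_; allFin; concatMap; map)
open import Data.Maybe using (Maybe; just; nothing; is-just; to-witness-T)
open import Data.Nat using (ℕ; zero; suc; _+_; _*_; _∸_; _≤_; _<_; _≤?_; z≤n; s≤s)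
open import Data.Nat.Properties as ℕ hiding (_≟_)
open import Algebra.Properties.Semiring.Sum +-*-semiring
  using (sum; sum-cong-≗; ∑-distrib-+; ∑-comm; *-distribˡ-sum; *-distribʳ-sum; sum-replicate-zero; sum-remove)
open import Data.Nat.Tactic.RingSolver using (solve)
open import Data.Product using (Σ; ∃; _×_; _,_; proj₁; proj₂)
open import Data.Sum using (_⊎_; inj₁; inj₂)
open import Data.Vec using (lookup; tabulate)
open import Data.Vec.Functional using (removeAt)
open import Data.Vec.Properties using (lookup∘tabulate)
open import Function using (_∘_)
open import Function.Construct.Identity using (↔-id)
open import Relation.Binary.Definitions using (tri<; tri≈; tri>)
open import Relation.Binary.PropositionalEquality
open import Relation.Nullary using (¬_; yes; no; contradiction; _×-dec_)
open import Relation.Nullary.Decidable using (⌊_⌋; toWitness; _→-dec_; T?)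
open ≡-Reasoning

-- Indicators and finite sums

ind : Bool → ℕ
ind b = if b then 1 else 0

ind-∧ : ∀ a b → ind (a ∧ b) ≡ ind a * ind b
ind-∧ false b = refl
ind-∧ true  b = sym (+-identityʳ (ind b))

ind-split : ∀ b a → ind b * a + ind (not b) * a ≡ a
ind-split true  a = trans (+-identityʳ (a + 0)) (+-identityʳ a)
ind-split false a = +-identityʳ a

ind-not+ind : ∀ b → ind (not b) + ind b ≡ 1
ind-not+ind true  = refl
ind-not+ind false = refl

ind-≤1 : ∀ b → ind b ≤ 1
ind-≤1 true  = s≤s z≤n
ind-≤1 false = z≤n

*-left-comm : ∀ a b c → a * (b * c) ≡ b * (a * c)
*-left-comm a b c = solve (a ∷ b ∷ c ∷ [])

⌊≟⌋-diag : ∀ {m} (i : Fin m) → ⌊ i ≟ i ⌋ ≡ true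
⌊≟⌋-diag i with i ≟ i
... | yes _  = refl
... | no i≢i = contradiction refl i≢i

⌊≟⌋⇒≡ : ∀ {m} {i j : Fin m} → ⌊ i ≟ j ⌋ ≡ true → i ≡ j
⌊≟⌋⇒≡ {i = i} {j} eq with i ≟ j
... | yes i≡j = i≡j

count≡sum : ∀ {v} (f : Fin v → Bool) → count f ≡ sum (ind ∘ f)
count≡sum {zero}  f = refl
count≡sum {suc v} f = cong (ind (f zero) +_) (count≡sum (f ∘ suc))

count-pos⇒∃ : ∀ {v} (f : Fin v → Bool) → 0 < count f → ∃ λ x → T (f x)
count-pos⇒∃ {suc v} f pos with f zero in eq
... | true  = zero , subst T (sym eq) _
... | false with count-pos⇒∃ (f ∘ suc) pos
...   | x , fx = suc x , fx

sum-const : ∀ v c → sum {v} (λ _ → c) ≡ v * c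
sum-const zero    c = refl
sum-const (suc v) c = cong (c +_) (sum-const v c)

sum-mono-≤ : ∀ {v} {f g : Fin v → ℕ} → (∀ x → f x ≤ g x) → sum f ≤ sum g
sum-mono-≤ {zero}  f≤g = z≤n
sum-mono-≤ {suc v} f≤g = +-mono-≤ (f≤g zero) (sum-mono-≤ (f≤g ∘ suc))

sum-δ : ∀ {v} (a : Fin v) (h : Fin v → ℕ) → sum (λ j → ind ⌊ a ≟ j ⌋ * h j) ≡ h a
sum-δ {suc v} zero    h =
  trans (cong₂ _+_ (+-identityʳ (h zero)) (sum-replicate-zero v)) (+-identityʳ (h zero))
sum-δ {suc v} (suc a) h =
  trans (sum-cong-≗ (λ j → cong (λ b → ind b * h (suc j)) (⌊suc≟suc⌋ a j))) (sum-δ a (λ j → h (suc j)))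
  where
  ⌊suc≟suc⌋ : ∀ {v} (a j : Fin v) → ⌊ suc a ≟ suc j ⌋ ≡ ⌊ a ≟ j ⌋
  ⌊suc≟suc⌋ a j with a ≟ j
  ... | yes _ = refl
  ... | no _  = refl

sum-by-class : ∀ {v m} (p : Fin v → Fin m) (g : Fin m → ℕ) (h : Fin v → ℕ) →
  sum (λ w → g (p w) * h w) ≡ sum (λ j → g j * sum (λ w → ind ⌊ p w ≟ j ⌋ * h w))
sum-by-class {v} p g h = begin
  sum (λ w → g (p w) * h w)
    ≡⟨ sum-cong-≗ (λ w → sym (sum-δ (p w) (λ j → g j * h w))) ⟩
  sum (λ w → sum (λ j → ind ⌊ p w ≟ j ⌋ * (g j * h w)))
    ≡⟨ ∑-comm (λ w j → ind ⌊ p w ≟ j ⌋ * (g j * h w)) ⟩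
  sum (λ j → sum (λ w → ind ⌊ p w ≟ j ⌋ * (g j * h w)))
    ≡⟨ sum-cong-≗ (λ j → trans (sum-cong-≗ {v} (λ w → *-left-comm (ind ⌊ p w ≟ j ⌋) (g j) (h w)))
                                (sym (*-distribˡ-sum (g j) (λ w → ind ⌊ p w ≟ j ⌋ * h w)))) ⟩
  sum (λ j → g j * sum (λ w → ind ⌊ p w ≟ j ⌋ * h w)) ∎

sum-partition : ∀ {v m} (p : Fin v → Fin m) (h : Fin v → ℕ) →
  sum h ≡ sum (λ j → sum (λ w → ind ⌊ p w ≟ j ⌋ * h w))
sum-partition p h = begin
  sum h                                              ≡⟨ sum-cong-≗ (λ w → sym (*-identityˡ (h w))) ⟩
  sum (λ w → 1 * h w)                                ≡⟨ sum-by-class p (λ _ → 1) h ⟩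
  sum (λ j → 1 * sum (λ w → ind ⌊ p w ≟ j ⌋ * h w))  ≡⟨ sum-cong-≗ (λ j → *-identityˡ (class-sum j)) ⟩
  sum class-sum                                      ∎
  where
  class-sum = λ j → sum (λ w → ind ⌊ p w ≟ j ⌋ * h w)

private
  weights-agree : ∀ {u v a b d} e → u * a + v * b ≡ u * (a + suc e) + v * d → a + b ≡ a + suc e + d → u ≡ v
  weights-agree {u} {v} {a} {b} {d} e eq₁ eq₂ = *-cancelʳ-≡ u v (suc e) (+-cancelˡ-≡ (u * a + v * d) _ _ (begin
    u * a + v * d + u * suc e ≡⟨ solve (u ∷ v ∷ a ∷ d ∷ e ∷ []) ⟩
    u * (a + suc e) + v * d   ≡⟨ eq₁ ⟨
    u * a + v * b             ≡⟨ cong (λ t → u * a + v * t) b≡ ⟩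
    u * a + v * (suc e + d)   ≡⟨ solve (u ∷ v ∷ a ∷ d ∷ e ∷ []) ⟩
    u * a + v * d + v * suc e ∎))
    where
    b≡ : b ≡ suc e + d
    b≡ = +-cancelˡ-≡ a _ _ (trans eq₂ (+-assoc a (suc e) d))

weighted-cancel : ∀ {u v a b c d} → u ≢ v → u * a + v * b ≡ u * c + v * d → a + b ≡ c + d → a ≡ c
weighted-cancel {u} {v} {a} {b} {c} {d} u≢v eq₁ eq₂ with <-cmp a c
... | tri≈ _ a≡c _ = a≡c
... | tri< a<c _ _ with m≤n⇒∃[o]m+o≡n a<c
...   | e , refl = contradiction (weights-agree e (trans eq₁ (cong (λ t → u * t + v * d) (sym (+-suc a e))))
                                                   (trans eq₂ (cong (_+ d) (sym (+-suc a e))))) u≢v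
weighted-cancel {u} {v} {a} {b} {c} {d} u≢v eq₁ eq₂ | tri> _ _ c<a with m≤n⇒∃[o]m+o≡n c<a
...   | e , refl = contradiction (weights-agree e (trans (sym eq₁) (cong (λ t → u * t + v * b) (sym (+-suc c e))))
                                                   (trans (sym eq₂) (cong (_+ b) (sym (+-suc c e))))) u≢v

-- Neighbour counts in divisible design graphs

module Adjacency {v} (K : Graph v) where

  A : Fin v → Fin v → ℕ
  A x y = ind (adj K x y)

  A-sym : ∀ x y → A x y ≡ A y x
  A-sym x y = cong ind (adj-sym K x y)

  degree≡sum : ∀ x → degree K x ≡ sum (A x)
  degree≡sum x = count≡sum (adj K x)

  common≡sum : ∀ x y → common K x y ≡ sum (λ w → A x w * A y w)
  common≡sum x y =
    trans (count≡sum (λ w → adj K x w ∧ adj K y w)) (sum-cong-≗ (λ w → ind-∧ (adj K x w) (adj K y w)))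

  common-self : ∀ x → common K x x ≡ degree K x
  common-self x = trans (common≡sum x x) (trans (sum-cong-≗ (λ w → ind-idem (adj K x w))) (sym (degree≡sum x)))
    where
    ind-idem : ∀ b → ind b * ind b ≡ ind b
    ind-idem true  = refl
    ind-idem false = refl

  module Classes {m} (p : Fin v → Fin m) where

    nbrs : Fin v → Fin m → ℕ
    nbrs x j = sum (λ y → ind ⌊ p y ≟ j ⌋ * A x y)

    nbrsIn≡nbrs : ∀ x j → nbrsIn K p x j ≡ nbrs x j
    nbrsIn≡nbrs x j = trans (count≡sum (λ y → adj K x y ∧ ⌊ p y ≟ j ⌋))
      (sum-cong-≗ (λ y → trans (ind-∧ (adj K x y) _) (*-comm (A x y) _)))

    degree≡∑nbrs : ∀ x → degree K x ≡ sum (nbrs x)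
    degree≡∑nbrs x = trans (degree≡sum x) (sum-partition p (A x))

    nbrs≤classSize : ∀ x j → nbrs x j ≤ sum (λ y → ind ⌊ p y ≟ j ⌋)
    nbrs≤classSize x j = sum-mono-≤ (λ y →
      subst (ind ⌊ p y ≟ j ⌋ * A x y ≤_) (*-identityʳ _)
            (*-monoʳ-≤ (ind ⌊ p y ≟ j ⌋) (ind-≤1 (adj K x y))))

module DivisibleDesign {m n : ℕ} {G : Graph (m * n)} {k λ₁ λ₂ : ℕ} {p : Fin (m * n) → Fin m}
                       (D : IsDDGPartition G k λ₁ λ₂ p) where

  open IsDDGPartition D
  open Adjacency G public
  open Classes p public

  classSize≡ : ∀ j → sum (λ y → ind ⌊ p y ≟ j ⌋) ≡ n
  classSize≡ j = trans (sym (count≡sum (λ y → ⌊ p y ≟ j ⌋))) (classSize j)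

  nbrs≤n : ∀ x j → nbrs x j ≤ n
  nbrs≤n x j = subst (nbrs x j ≤_) (classSize≡ j) (nbrs≤classSize x j)

  ∑nbrs : ∀ x → sum (nbrs x) ≡ k
  ∑nbrs x = trans (sym (degree≡∑nbrs x)) (regular x)

  common-expansion : ∀ w y →
    common G w y + λ₁ * ind ⌊ y ≟ w ⌋ ≡ k * ind ⌊ y ≟ w ⌋ + λ₁ * ind ⌊ p w ≟ p y ⌋ + λ₂ * ind (not ⌊ p w ≟ p y ⌋)
  common-expansion w y with y ≟ w
  ... | yes refl rewrite ⌊≟⌋-diag (p y) =
    trans (cong (_+ λ₁ * 1) (trans (common-self y) (regular y))) (solve (k ∷ λ₁ ∷ λ₂ ∷ []))
  ... | no y≢w with p w ≟ p y
  ...   | yes same = trans (cong (_+ λ₁ * 0) (sameClass w y (y≢w ∘ sym) same)) (solve (k ∷ λ₁ ∷ λ₂ ∷ []))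
  ...   | no diff  = trans (cong (_+ λ₁ * 0) (diffClass w y diff)) (solve (k ∷ λ₁ ∷ λ₂ ∷ []))

  walks : Fin (m * n) → Fin (m * n) → ℕ
  walks x y = sum (λ w → A x w * common G w y)

  walks-sym : ∀ x y → walks x y ≡ walks y x
  walks-sym x y = begin
    walks x y                                      ≡⟨ expand x y ⟩
    sum (λ w → sum (λ u → A x w * A w u * A y u))  ≡⟨ ∑-comm (λ w u → A x w * A w u * A y u) ⟩
    sum (λ u → sum (λ w → A x w * A w u * A y u))  ≡⟨ sum-cong-≗ (λ u → sum-cong-≗ (reverse u)) ⟩
    sum (λ u → sum (λ w → A y u * A u w * A x w))  ≡⟨ expand y x ⟨
    walks y x                                      ∎
    where
    expand : ∀ x y → walks x y ≡ sum (λ w → sum (λ u → A x w * A w u * A y u))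
    expand x y = sum-cong-≗ (λ w → begin
      A x w * common G w y                 ≡⟨ cong (A x w *_) (common≡sum w y) ⟩
      A x w * sum (λ u → A w u * A y u)    ≡⟨ *-distribˡ-sum (A x w) (λ u → A w u * A y u) ⟩
      sum (λ u → A x w * (A w u * A y u))  ≡⟨ sum-cong-≗ (λ u → sym (*-assoc (A x w) (A w u) (A y u))) ⟩
      sum (λ u → A x w * A w u * A y u)    ∎)
    reverse : ∀ u w → A x w * A w u * A y u ≡ A y u * A u w * A x w
    reverse u w rewrite A-sym w u = *-rev (A x w) (A u w) (A y u)
      where
      *-rev : ∀ a b c → a * b * c ≡ c * b * a
      *-rev a b c = solve (a ∷ b ∷ c ∷ [])

  far : Fin (m * n) → Fin (m * n) → ℕ
  far x y = sum (λ w → ind (not ⌊ p w ≟ p y ⌋) * A x w)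

  near+far : ∀ x y → nbrs x (p y) + far x y ≡ k
  near+far x y = begin
    nbrs x (p y) + far x y
      ≡⟨ ∑-distrib-+ (λ w → ind ⌊ p w ≟ p y ⌋ * A x w) (λ w → ind (not ⌊ p w ≟ p y ⌋) * A x w) ⟨
    sum (λ w → ind ⌊ p w ≟ p y ⌋ * A x w + ind (not ⌊ p w ≟ p y ⌋) * A x w)
      ≡⟨ sum-cong-≗ (λ w → ind-split ⌊ p w ≟ p y ⌋ (A x w)) ⟩
    sum (A x)
      ≡⟨ degree≡sum x ⟨
    degree G x
      ≡⟨ regular x ⟩
    k ∎

  walks-formula : ∀ x y → walks x y + λ₁ * A x y ≡ k * A x y + λ₁ * nbrs x (p y) + λ₂ * far x y
  walks-formula x y = begin
    walks x y + λ₁ * A x y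
      ≡⟨ cong (λ t → walks x y + λ₁ * t) (sym (sum-δ y (A x))) ⟩
    walks x y + λ₁ * sum δA
      ≡⟨ cong (walks x y +_) (*-distribˡ-sum λ₁ δA) ⟩
    walks x y + sum (λ w → λ₁ * δA w)
      ≡⟨ ∑-distrib-+ (λ w → A x w * common G w y) (λ w → λ₁ * δA w) ⟨
    sum (λ w → A x w * common G w y + λ₁ * δA w)
      ≡⟨ sum-cong-≗ pointwise ⟩
    sum (λ w → k * δA w + λ₁ * nearA w + λ₂ * farA w)
      ≡⟨ ∑-distrib-+ (λ w → k * δA w + λ₁ * nearA w) (λ w → λ₂ * farA w) ⟩
    sum (λ w → k * δA w + λ₁ * nearA w) + sum (λ w → λ₂ * farA w)
      ≡⟨ cong (_+ sum (λ w → λ₂ * farA w)) (∑-distrib-+ (λ w → k * δA w) (λ w → λ₁ * nearA w)) ⟩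
    sum (λ w → k * δA w) + sum (λ w → λ₁ * nearA w) + sum (λ w → λ₂ * farA w)
      ≡⟨ cong₂ _+_ (cong₂ _+_ (*-distribˡ-sum k δA) (*-distribˡ-sum λ₁ nearA)) (*-distribˡ-sum λ₂ farA) ⟨
    k * sum δA + λ₁ * nbrs x (p y) + λ₂ * far x y
      ≡⟨ cong (λ t → k * t + λ₁ * nbrs x (p y) + λ₂ * far x y) (sum-δ y (A x)) ⟩
    k * A x y + λ₁ * nbrs x (p y) + λ₂ * far x y ∎
    where
    δA nearA farA : Fin (m * n) → ℕ
    δA w = ind ⌊ y ≟ w ⌋ * A x w
    nearA w = ind ⌊ p w ≟ p y ⌋ * A x w
    farA w = ind (not ⌊ p w ≟ p y ⌋) * A x w
    factor : ∀ a c l d → a * c + l * (d * a) ≡ a * (c + l * d)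
    factor a c l d = solve (a ∷ c ∷ l ∷ d ∷ [])
    distribute : ∀ a k l₁ l₂ d s t →
      a * (k * d + l₁ * s + l₂ * t) ≡ k * (d * a) + l₁ * (s * a) + l₂ * (t * a)
    distribute a k l₁ l₂ d s t = solve (a ∷ k ∷ l₁ ∷ l₂ ∷ d ∷ s ∷ t ∷ [])
    pointwise : ∀ w → A x w * common G w y + λ₁ * δA w ≡ k * δA w + λ₁ * nearA w + λ₂ * farA w
    pointwise w = begin
      A x w * common G w y + λ₁ * δA w
        ≡⟨ factor (A x w) (common G w y) λ₁ (ind ⌊ y ≟ w ⌋) ⟩
      A x w * (common G w y + λ₁ * ind ⌊ y ≟ w ⌋)
        ≡⟨ cong (A x w *_) (common-expansion w y) ⟩
      A x w * (k * ind ⌊ y ≟ w ⌋ + λ₁ * ind ⌊ p w ≟ p y ⌋ + λ₂ * ind (not ⌊ p w ≟ p y ⌋))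
        ≡⟨ distribute (A x w) k λ₁ λ₂ _ _ _ ⟩
      k * δA w + λ₁ * nearA w + λ₂ * farA w ∎

  -- walks is symmetric, and nbrs x (p y) + far x y = k on both sides of walks-formula.
  nbrs-sym : λ₁ ≢ λ₂ → ∀ x y → nbrs x (p y) ≡ nbrs y (p x)
  nbrs-sym λ₁≢λ₂ x y = weighted-cancel λ₁≢λ₂ weighted (trans (near+far x y) (sym (near+far y x)))
    where
    weighted : λ₁ * nbrs x (p y) + λ₂ * far x y ≡ λ₁ * nbrs y (p x) + λ₂ * far y x
    weighted = +-cancelˡ-≡ (k * A x y) _ _ (begin
      k * A x y + (λ₁ * nbrs x (p y) + λ₂ * far x y)  ≡⟨ +-assoc (k * A x y) _ _ ⟨
      k * A x y + λ₁ * nbrs x (p y) + λ₂ * far x y    ≡⟨ walks-formula x y ⟨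
      walks x y + λ₁ * A x y                          ≡⟨ cong₂ (λ s t → s + λ₁ * t) (walks-sym x y)
                                                                                     (A-sym x y) ⟩
      walks y x + λ₁ * A y x                          ≡⟨ walks-formula y x ⟩
      k * A y x + λ₁ * nbrs y (p x) + λ₂ * far y x    ≡⟨ cong (λ t → k * t + λ₁ * nbrs y (p x) + λ₂ * far y x)
                                                               (A-sym y x) ⟩
      k * A x y + λ₁ * nbrs y (p x) + λ₂ * far y x    ≡⟨ +-assoc (k * A x y) _ _ ⟩
      k * A x y + (λ₁ * nbrs y (p x) + λ₂ * far y x)  ∎)

  class-common : ∀ x → sum (λ y → ind ⌊ p y ≟ p x ⌋ * common G x y) + λ₁ ≡ λ₁ * n + k
  class-common x = begin
    S + λ₁
      ≡⟨ cong (S +_) (trans (cong (λ₁ *_) (sum-δ x (λ _ → 1))) (*-identityʳ λ₁)) ⟨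
    S + λ₁ * sum (λ y → ind ⌊ x ≟ y ⌋ * 1)
      ≡⟨ cong (S +_) (*-distribˡ-sum λ₁ (λ y → ind ⌊ x ≟ y ⌋ * 1)) ⟩
    S + sum (λ y → λ₁ * (ind ⌊ x ≟ y ⌋ * 1))
      ≡⟨ ∑-distrib-+ (λ y → ind ⌊ p y ≟ p x ⌋ * common G x y) (λ y → λ₁ * (ind ⌊ x ≟ y ⌋ * 1)) ⟨
    sum (λ y → ind ⌊ p y ≟ p x ⌋ * common G x y + λ₁ * (ind ⌊ x ≟ y ⌋ * 1))
      ≡⟨ sum-cong-≗ pointwise ⟩
    sum (λ y → λ₁ * ind ⌊ p y ≟ p x ⌋ + k * (ind ⌊ x ≟ y ⌋ * 1))
      ≡⟨ ∑-distrib-+ (λ y → λ₁ * ind ⌊ p y ≟ p x ⌋) (λ y → k * (ind ⌊ x ≟ y ⌋ * 1)) ⟩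
    sum (λ y → λ₁ * ind ⌊ p y ≟ p x ⌋) + sum (λ y → k * (ind ⌊ x ≟ y ⌋ * 1))
      ≡⟨ cong₂ _+_ (*-distribˡ-sum λ₁ (λ y → ind ⌊ p y ≟ p x ⌋))
                   (*-distribˡ-sum k (λ y → ind ⌊ x ≟ y ⌋ * 1)) ⟨
    λ₁ * sum (λ y → ind ⌊ p y ≟ p x ⌋) + k * sum (λ y → ind ⌊ x ≟ y ⌋ * 1)
      ≡⟨ cong₂ (λ s t → λ₁ * s + k * t) (classSize≡ (p x)) (sum-δ x (λ _ → 1)) ⟩
    λ₁ * n + k * 1
      ≡⟨ cong (λ₁ * n +_) (*-identityʳ k) ⟩
    λ₁ * n + k ∎
    where
    S = sum (λ y → ind ⌊ p y ≟ p x ⌋ * common G x y)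
    pointwise : ∀ y → ind ⌊ p y ≟ p x ⌋ * common G x y + λ₁ * (ind ⌊ x ≟ y ⌋ * 1)
                    ≡ λ₁ * ind ⌊ p y ≟ p x ⌋ + k * (ind ⌊ x ≟ y ⌋ * 1)
    pointwise y with x ≟ y
    ... | yes refl rewrite ⌊≟⌋-diag (p x) | common-self x | regular x = solve (k ∷ λ₁ ∷ [])
    ... | no x≢y with p y ≟ p x
    ...   | yes same rewrite sameClass x y x≢y (sym same) = solve (k ∷ λ₁ ∷ [])
    ...   | no _ = solve (k ∷ λ₁ ∷ [])

  class-common≡∑nbrs² : λ₁ ≢ λ₂ → ∀ x →
    sum (λ y → ind ⌊ p y ≟ p x ⌋ * common G x y) ≡ sum (λ j → nbrs x j * nbrs x j)
  class-common≡∑nbrs² λ₁≢λ₂ x = begin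
    sum (λ y → ind ⌊ p y ≟ p x ⌋ * common G x y)
      ≡⟨ sum-cong-≗ (λ y → trans (cong (ind ⌊ p y ≟ p x ⌋ *_) (common≡sum x y))
                                 (*-distribˡ-sum (ind ⌊ p y ≟ p x ⌋) (λ w → A x w * A y w))) ⟩
    sum (λ y → sum (λ w → ind ⌊ p y ≟ p x ⌋ * (A x w * A y w)))
      ≡⟨ ∑-comm (λ y w → ind ⌊ p y ≟ p x ⌋ * (A x w * A y w)) ⟩
    sum (λ w → sum (λ y → ind ⌊ p y ≟ p x ⌋ * (A x w * A y w)))
      ≡⟨ sum-cong-≗ (λ w → trans (sum-cong-≗ (λ y → rearrange w y))
                                 (sym (*-distribˡ-sum (A x w) (λ y → ind ⌊ p y ≟ p x ⌋ * A w y)))) ⟩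
    sum (λ w → A x w * nbrs w (p x))
      ≡⟨ sum-cong-≗ (λ w → trans (cong (A x w *_) (nbrs-sym λ₁≢λ₂ w x)) (*-comm (A x w) (nbrs x (p w)))) ⟩
    sum (λ w → nbrs x (p w) * A x w)
      ≡⟨ sum-by-class p (nbrs x) (A x) ⟩
    sum (λ j → nbrs x j * nbrs x j) ∎
    where
    rearrange : ∀ w y → ind ⌊ p y ≟ p x ⌋ * (A x w * A y w) ≡ A x w * (ind ⌊ p y ≟ p x ⌋ * A w y)
    rearrange w y rewrite A-sym y w = *-left-comm (ind ⌊ p y ≟ p x ⌋) (A x w) (A w y)

  ∑nbrs² : λ₁ ≢ λ₂ → ∀ x → sum (λ j → nbrs x j * nbrs x j) + λ₁ ≡ λ₁ * n + k
  ∑nbrs² λ₁≢λ₂ x = trans (cong (_+ λ₁) (sym (class-common≡∑nbrs² λ₁≢λ₂ x))) (class-common x)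

module QuotientMatrix {m n : ℕ} {G : Graph (m * n)} {k λ₁ λ₂ : ℕ} {p : Fin (m * n) → Fin m}
                      (D : IsDDGPartition G k λ₁ λ₂ p) (λ₁≢λ₂ : λ₁ ≢ λ₂) (n>0 : 0 < n) where

  open IsDDGPartition D
  open DivisibleDesign D

  representative : ∀ i → ∃ λ x → p x ≡ i
  representative i with count-pos⇒∃ (λ x → ⌊ p x ≟ i ⌋) (subst (0 <_) (sym (classSize i)) n>0)
  ... | x , px≟i = x , toWitness px≟i

  rep : Fin m → Fin (m * n)
  rep i = proj₁ (representative i)

  R : Fin m → Fin m → ℕ
  R i j = nbrs (rep i) j

  nbrs-flip : ∀ x i → nbrs x i ≡ nbrs (rep i) (p x)
  nbrs-flip x i = trans (cong (nbrs x) (sym (proj₂ (representative i)))) (nbrs-sym λ₁≢λ₂ x (rep i))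

  R-sym : ∀ i j → R i j ≡ R j i
  R-sym i j = trans (nbrs-flip (rep i) j) (cong (R j) (proj₂ (representative i)))

  nbrs≡R : ∀ x j → nbrs x j ≡ R (p x) j
  nbrs≡R x j = trans (nbrs-flip x j) (R-sym j (p x))

-- Rows of the quotient matrix: a quadratic Diophantine system

oneAt dualAt : ℕ → ∀ {v} → Fin v → Fin v → ℕ
oneAt  n a j = if ⌊ a ≟ j ⌋ then 1 else n ∸ 1
dualAt n a j = if ⌊ a ≟ j ⌋ then n ∸ 1 else 1

three-ones : ∀ b c d → b + c + d ≡ 3 → b * c + b * d + c * d ≡ 3 → b ≡ 1 × c ≡ 1 × d ≡ 1
three-ones 0 0 .3 refl ()
three-ones 0 1 .2 refl ()
three-ones 0 2 .1 refl ()
three-ones 0 3 .0 refl ()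
three-ones 0 (suc (suc (suc (suc c)))) d ()
three-ones 1 0 .2 refl ()
three-ones 1 1 .1 refl _ = refl , refl , refl
three-ones 1 2 .0 refl ()
three-ones 1 (suc (suc (suc c))) d ()
three-ones 2 0 .1 refl ()
three-ones 2 1 .0 refl ()
three-ones 2 (suc (suc c)) d ()
three-ones 3 0 .0 refl ()
three-ones 3 (suc c) d ()
three-ones (suc (suc (suc (suc b)))) c d ()

pairs≤square : ∀ b c d → b * c + b * d + c * d ≤ (b + c + d) * (b + c + d)
pairs≤square b c d = subst (b * c + b * d + c * d ≤_) (expand b c d) (m≤m+n (b * c + b * d + c * d) _)
  where
  expand : ∀ b c d → b * c + b * d + c * d + (b * b + c * c + d * d + (b * c + b * d + c * d))
                   ≡ (b + c + d) * (b + c + d)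
  expand b c d = solve (b ∷ c ∷ d ∷ [])

pairs-from-squares : ∀ n a b c d → a + (b + c + d) ≡ n + 2 →
  a * a + (b * b + c * c + d * d) + 2 * n ≡ n * n + 4 →
  a * (b + c + d) + (b * c + b * d + c * d) ≡ 3 * n
pairs-from-squares n a b c d Σ≡ Σ²≡ = *-cancelˡ-≡ _ _ 2 (+-cancelˡ-≡ (n * n + 4) _ _ (begin
  n * n + 4 + 2 * P                                ≡⟨ cong (_+ 2 * P) (sym Σ²≡) ⟩
  a * a + (b * b + c * c + d * d) + 2 * n + 2 * P  ≡⟨ square-of-sum n a b c d ⟩
  (a + (b + c + d)) * (a + (b + c + d)) + 2 * n    ≡⟨ cong (λ s → s * s + 2 * n) Σ≡ ⟩
  (n + 2) * (n + 2) + 2 * n                        ≡⟨ expand n ⟩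
  n * n + 4 + 2 * (3 * n)                          ∎))
  where
  P = a * (b + c + d) + (b * c + b * d + c * d)
  square-of-sum : ∀ n a b c d →
    a * a + (b * b + c * c + d * d) + 2 * n + 2 * (a * (b + c + d) + (b * c + b * d + c * d))
      ≡ (a + (b + c + d)) * (a + (b + c + d)) + 2 * n
  square-of-sum n a b c d = solve (n ∷ a ∷ b ∷ c ∷ d ∷ [])
  expand : ∀ n → (n + 2) * (n + 2) + 2 * n ≡ n * n + 4 + 2 * (3 * n)
  expand n = solve (n ∷ [])

-- e is the excess n − a of the large entry: e = 0 makes q = a ≥ 9 exceed (b + c + d)² = 4, and e ≥ 2
-- bounds n = a + e by 8.
excess≡1 : ∀ {a b c d} e → 4 ≤ a → 9 ≤ a + e → b + c + d ≡ e + 2 →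
  a * (e + 2) + (b * c + b * d + c * d) ≡ 3 * (a + e) → e ≡ 1
excess≡1 {a} {b} {c} {d} 0 _ 9≤a Σ≡ pairs =
  contradiction (≤-trans 9≤a (≤-reflexive (+-identityʳ a))) (<⇒≱ (s≤s (≤-trans a≤4 (m≤m+n 4 4))))
  where
  q≡a : b * c + b * d + c * d ≡ a
  q≡a = +-cancelˡ-≡ (a * 2) _ _ (trans pairs (three-halves a))
    where
    three-halves : ∀ a → 3 * (a + 0) ≡ a * 2 + a
    three-halves a = solve (a ∷ [])
  a≤4 : a ≤ 4
  a≤4 = ≤-trans (≤-trans (≤-reflexive (sym q≡a)) (pairs≤square b c d))
                (≤-reflexive (cong (λ s → s * s) Σ≡))
excess≡1 1 _ _ _ _ = refl
excess≡1 {a} {b} {c} {d} (suc (suc β)) 4≤a 9≤n Σ≡ pairs with m≤n⇒∃[o]m+o≡n 4≤a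
... | α , refl = contradiction (≤-trans (m≤m+n (α + β) (α * β)) (≤-trans (m≤m+n _ q) (≤-reflexive small)))
                               (<⇒≱ (+-cancelˡ-≤ 6 3 (α + β) (≤-trans 9≤n (≤-reflexive (regroup α β)))))
  where
  q = b * c + b * d + c * d
  regroup : ∀ α β → 4 + α + suc (suc β) ≡ 6 + (α + β)
  regroup α β = solve (α ∷ β ∷ [])
  small : α + β + α * β + q ≡ 2
  small = +-cancelˡ-≡ (3 * (6 + (α + β))) _ _ (begin
    3 * (6 + (α + β)) + (α + β + α * β + q)  ≡⟨ expand α β q ⟩
    (4 + α) * (suc (suc β) + 2) + q + 2      ≡⟨ cong (_+ 2) pairs ⟩
    3 * (4 + α + suc (suc β)) + 2            ≡⟨ cong (λ s → 3 * s + 2) (regroup α β) ⟩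
    3 * (6 + (α + β)) + 2                    ∎)
    where
    expand : ∀ α β q → 3 * (6 + (α + β)) + (α + β + α * β + q) ≡ (4 + α) * (suc (suc β) + 2) + q + 2
    expand α β q = solve (α ∷ β ∷ q ∷ [])

large-entry : ∀ {n a b c d} → 9 ≤ n → 4 ≤ a → a ≤ n → a + (b + c + d) ≡ n + 2 →
  a * a + (b * b + c * c + d * d) + 2 * n ≡ n * n + 4 → suc a ≡ n × b ≡ 1 × c ≡ 1 × d ≡ 1
large-entry {n} {a} {b} {c} {d} 9≤n 4≤a a≤n Σ≡ Σ²≡ with m≤n⇒∃[o]m+o≡n a≤n
... | e , refl = conclude e (excess≡1 {a} {b} {c} {d} e 4≤a 9≤n Σ≡′ pairs′) Σ≡′ pairs′
  where
  q = b * c + b * d + c * d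
  Σ≡′ : b + c + d ≡ e + 2
  Σ≡′ = +-cancelˡ-≡ a _ _ (trans Σ≡ (+-assoc a e 2))
  pairs′ : a * (e + 2) + q ≡ 3 * (a + e)
  pairs′ = trans (cong (λ s → a * s + q) (sym Σ≡′)) (pairs-from-squares (a + e) a b c d Σ≡ Σ²≡)
  three-thirds : ∀ a → 3 * (a + 1) ≡ a * 3 + 3
  three-thirds a = solve (a ∷ [])
  conclude : ∀ e → e ≡ 1 → b + c + d ≡ e + 2 → a * (e + 2) + q ≡ 3 * (a + e) →
    suc a ≡ a + e × b ≡ 1 × c ≡ 1 × d ≡ 1
  conclude .1 refl Σ≡ pairs =
    +-comm 1 a , three-ones b c d Σ≡ (+-cancelˡ-≡ (a * 3) _ _ (trans pairs (three-thirds a)))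

small-entries : ∀ {n} → 9 ≤ n → (f : Fin 4 → ℕ) → (∀ j → f j ≤ 3) → sum f ≡ n + 2 →
  sum (λ j → f j * f j) + 2 * n ≢ n * n + 4
small-entries {n} 9≤n f f≤3 Σf Σf² with m≤n⇒∃[o]m+o≡n 9≤n
... | t , refl = <⇒≱ (subst₂ _<_ (sym (lhs t)) (sym (rhs t)) (m<m+n (51 + 5 * t) (s≤s z≤n)))
  (≤-trans (+-monoˡ-≤ 4 (*-monoˡ-≤ (9 + t) 9≤n))
  (≤-trans (≤-reflexive (sym Σf²))
  (≤-trans (+-monoˡ-≤ (2 * (9 + t)) squares≤)
           (≤-reflexive (cong (λ s → 3 * s + 2 * (9 + t)) Σf)))))
  where
  squares≤ : sum (λ j → f j * f j) ≤ 3 * sum f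
  squares≤ = ≤-trans (sum-mono-≤ (λ j → *-monoˡ-≤ (f j) (f≤3 j))) (≤-reflexive (sym (*-distribˡ-sum 3 f)))
  lhs : ∀ t → 3 * (9 + t + 2) + 2 * (9 + t) ≡ 51 + 5 * t
  lhs t = solve (t ∷ [])
  rhs : ∀ t → 9 * (9 + t) + 4 ≡ 51 + 5 * t + (34 + 4 * t)
  rhs t = solve (t ∷ [])

dual-row : ∀ {n} → 9 ≤ n → (f : Fin 4 → ℕ) → (∀ j → f j ≤ n) → sum f ≡ n + 2 →
  sum (λ j → f j * f j) + 2 * n ≡ n * n + 4 → ∃ λ i → ∀ j → f j ≡ dualAt n i j
dual-row {n} 9≤n f f≤n Σf Σf² with any? (λ j → 4 ≤? f j)
... | no none-large =
  contradiction Σf² (small-entries 9≤n f (λ j → ≤-pred (≰⇒> (λ 4≤fj → none-large (j , 4≤fj)))) Σf)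
... | yes (i , 4≤fi) with large-entry {n} {f i} {g zero} {g (suc zero)} {g (suc (suc zero))}
                                      9≤n 4≤fi (f≤n i) Σ≡ Σ²≡
  where
  g : Fin 3 → ℕ
  g = removeAt f i
  sum₃ : ∀ (h : Fin 3 → ℕ) → sum h ≡ h zero + h (suc zero) + h (suc (suc zero))
  sum₃ h = trans (cong (λ s → h zero + (h (suc zero) + s)) (+-identityʳ _)) (sym (+-assoc (h zero) _ _))
  Σ≡ : f i + (g zero + g (suc zero) + g (suc (suc zero))) ≡ n + 2
  Σ≡ = trans (cong (f i +_) (sym (sum₃ g))) (trans (sym (sum-remove f)) Σf)
  Σ²≡ : f i * f i + (g zero * g zero + g (suc zero) * g (suc zero) + g (suc (suc zero)) * g (suc (suc zero)))
        + 2 * n ≡ n * n + 4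
  Σ²≡ = trans (cong (λ s → f i * f i + s + 2 * n) (sym (sum₃ (λ k → g k * g k))))
              (trans (cong (_+ 2 * n) (sym (sum-remove (λ j → f j * f j)))) Σf²)
... | fi+1≡n , b≡1 , c≡1 , d≡1 = i , shape
  where
  others : ∀ k → f (punchIn i k) ≡ 1
  others zero             = b≡1
  others (suc zero)       = c≡1
  others (suc (suc zero)) = d≡1
  shape : ∀ j → f j ≡ dualAt n i j
  shape j with i ≟ j
  ... | yes refl = cong (_∸ 1) fi+1≡n
  ... | no i≢j  = trans (cong f (sym (punchIn-punchOut i≢j))) (others (punchOut i≢j))

complement-sum : ∀ {v n} (r : Fin v → ℕ) → (∀ j → r j ≤ n) → sum (λ j → n ∸ r j) + sum r ≡ v * n
complement-sum {v} {n} r r≤n = begin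
  sum (λ j → n ∸ r j) + sum r  ≡⟨ ∑-distrib-+ (λ j → n ∸ r j) r ⟨
  sum (λ j → n ∸ r j + r j)    ≡⟨ sum-cong-≗ (λ j → m∸n+n≡m (r≤n j)) ⟩
  sum {v} (λ _ → n)            ≡⟨ sum-const v n ⟩
  v * n                        ∎

complement-sum² : ∀ {v n} (r : Fin v → ℕ) → (∀ j → r j ≤ n) →
  sum (λ j → (n ∸ r j) * (n ∸ r j)) + 2 * n * sum r ≡ v * (n * n) + sum (λ j → r j * r j)
complement-sum² {v} {n} r r≤n = begin
  sum (λ j → (n ∸ r j) * (n ∸ r j)) + 2 * n * sum r
    ≡⟨ cong (sum (λ j → (n ∸ r j) * (n ∸ r j)) +_) (*-distribˡ-sum (2 * n) r) ⟩
  sum (λ j → (n ∸ r j) * (n ∸ r j)) + sum (λ j → 2 * n * r j)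
    ≡⟨ ∑-distrib-+ (λ j → (n ∸ r j) * (n ∸ r j)) (λ j → 2 * n * r j) ⟨
  sum (λ j → (n ∸ r j) * (n ∸ r j) + 2 * n * r j)
    ≡⟨ sum-cong-≗ pointwise ⟩
  sum (λ j → n * n + r j * r j)
    ≡⟨ ∑-distrib-+ {v} (λ _ → n * n) (λ j → r j * r j) ⟩
  sum {v} (λ _ → n * n) + sum (λ j → r j * r j)
    ≡⟨ cong (_+ sum (λ j → r j * r j)) (sum-const v (n * n)) ⟩
  v * (n * n) + sum (λ j → r j * r j) ∎
  where
  square-identity : ∀ r f → f * f + 2 * (r + f) * r ≡ (r + f) * (r + f) + r * r
  square-identity r f = solve (r ∷ f ∷ [])
  pointwise : ∀ j → (n ∸ r j) * (n ∸ r j) + 2 * n * r j ≡ n * n + r j * r j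
  pointwise j with n ∸ r j | m+[n∸m]≡n (r≤n j)
  ... | f | refl = square-identity (r j) f

-- The complementary row n − r has sum n + 2 and square sum (n − 1)² + 3.
row-shape : ∀ {n} → 9 ≤ n → (r : Fin 4 → ℕ) → (∀ j → r j ≤ n) → sum r + 2 ≡ 3 * n →
  sum (λ j → r j * r j) + 6 * n ≡ 3 * (n * n) + 4 → ∃ λ a → ∀ j → r j ≡ oneAt n a j
row-shape {n} 9≤n r r≤n Σr Σr² with dual-row 9≤n (λ j → n ∸ r j) (λ j → m∸n≤m n (r j)) Σf Σf²
  where
  Σf : sum (λ j → n ∸ r j) ≡ n + 2
  Σf = +-cancelʳ-≡ (sum r + 2) _ _ (begin
    sum (λ j → n ∸ r j) + (sum r + 2)  ≡⟨ +-assoc (sum (λ j → n ∸ r j)) (sum r) 2 ⟨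
    sum (λ j → n ∸ r j) + sum r + 2    ≡⟨ cong (_+ 2) (complement-sum r r≤n) ⟩
    4 * n + 2                          ≡⟨ regroup n ⟩
    n + 2 + 3 * n                      ≡⟨ cong (n + 2 +_) (sym Σr) ⟩
    n + 2 + (sum r + 2)                ∎)
    where
    regroup : ∀ n → 4 * n + 2 ≡ n + 2 + 3 * n
    regroup n = solve (n ∷ [])
  Σf² : sum (λ j → (n ∸ r j) * (n ∸ r j)) + 2 * n ≡ n * n + 4
  Σf² = +-cancelʳ-≡ (2 * n * (3 * n)) _ _ (begin
    X + 2 * n + 2 * n * (3 * n)        ≡⟨ cong (λ s → X + 2 * n + 2 * n * s) (sym Σr) ⟩
    X + 2 * n + 2 * n * (sum r + 2)    ≡⟨ regroup X n (sum r) ⟩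
    X + 2 * n * sum r + 6 * n          ≡⟨ cong (_+ 6 * n) (complement-sum² r r≤n) ⟩
    4 * (n * n) + Z + 6 * n            ≡⟨ +-assoc (4 * (n * n)) Z (6 * n) ⟩
    4 * (n * n) + (Z + 6 * n)          ≡⟨ cong (4 * (n * n) +_) Σr² ⟩
    4 * (n * n) + (3 * (n * n) + 4)    ≡⟨ regroup′ n ⟩
    n * n + 4 + 2 * n * (3 * n)        ∎)
    where
    X = sum (λ j → (n ∸ r j) * (n ∸ r j))
    Z = sum (λ j → r j * r j)
    regroup : ∀ x n s → x + 2 * n + 2 * n * (s + 2) ≡ x + 2 * n * s + 6 * n
    regroup x n s = solve (x ∷ n ∷ s ∷ [])
    regroup′ : ∀ n → 4 * (n * n) + (3 * (n * n) + 4) ≡ n * n + 4 + 2 * n * (3 * n)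
    regroup′ n = solve (n ∷ [])
... | a , f≡dual = a , λ j → trans (sym (m∸[m∸n]≡n (r≤n j))) (trans (cong (n ∸_) (f≡dual j)) (flip j))
  where
  flip : ∀ j → n ∸ dualAt n a j ≡ oneAt n a j
  flip j with a ≟ j
  ... | yes _ = m∸[m∸n]≡n (≤-trans (s≤s z≤n) 9≤n)
  ... | no _  = refl

oneAt≡1 : ∀ {n} → 3 ≤ n → ∀ {v} (a j : Fin v) → oneAt n a j ≡ 1 → a ≡ j
oneAt≡1 3≤n a j eq with a ≟ j
... | yes a≡j = a≡j
... | no _    = contradiction (subst (2 ≤_) eq (∸-monoˡ-≤ 1 3≤n)) λ { (s≤s ()) }

sum-oneAt-on : ∀ {v} n (a : Fin v) (b : Fin v → Bool) →
  sum (λ j → ind (b j) * oneAt n a j) + ind (b a) * (n ∸ 1) ≡ ind (b a) + count b * (n ∸ 1)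
sum-oneAt-on {v} n a b = begin
  S + ind (b a) * (n ∸ 1)
    ≡⟨ cong (S +_) (sym (sum-δ a (λ j → ind (b j) * (n ∸ 1)))) ⟩
  S + sum (λ j → ind ⌊ a ≟ j ⌋ * (ind (b j) * (n ∸ 1)))
    ≡⟨ ∑-distrib-+ (λ j → ind (b j) * oneAt n a j) (λ j → ind ⌊ a ≟ j ⌋ * (ind (b j) * (n ∸ 1))) ⟨
  sum (λ j → ind (b j) * oneAt n a j + ind ⌊ a ≟ j ⌋ * (ind (b j) * (n ∸ 1)))
    ≡⟨ sum-cong-≗ pointwise ⟩
  sum (λ j → ind ⌊ a ≟ j ⌋ * ind (b j) + ind (b j) * (n ∸ 1))
    ≡⟨ ∑-distrib-+ (λ j → ind ⌊ a ≟ j ⌋ * ind (b j)) (λ j → ind (b j) * (n ∸ 1)) ⟩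
  sum (λ j → ind ⌊ a ≟ j ⌋ * ind (b j)) + sum (λ j → ind (b j) * (n ∸ 1))
    ≡⟨ cong₂ _+_ (sum-δ a (ind ∘ b)) (sym (*-distribʳ-sum (n ∸ 1) (ind ∘ b))) ⟩
  ind (b a) + sum (ind ∘ b) * (n ∸ 1)
    ≡⟨ cong (λ s → ind (b a) + s * (n ∸ 1)) (count≡sum b) ⟨
  ind (b a) + count b * (n ∸ 1) ∎
  where
  S = sum (λ j → ind (b j) * oneAt n a j)
  rearrange : ∀ x m → x * 1 + 1 * (x * m) ≡ 1 * x + x * m
  rearrange x m = solve (x ∷ m ∷ [])
  pointwise : ∀ j → ind (b j) * oneAt n a j + ind ⌊ a ≟ j ⌋ * (ind (b j) * (n ∸ 1))
                  ≡ ind ⌊ a ≟ j ⌋ * ind (b j) + ind (b j) * (n ∸ 1)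
  pointwise j with a ≟ j
  ... | yes _ = rearrange (ind (b j)) (n ∸ 1)
  ... | no _  = +-identityʳ _

sum-dualAt : ∀ {n} → 1 ≤ n → (a : Fin 4) → sum (dualAt n a) ≡ n + 2
sum-dualAt {n} 1≤n a = +-cancelʳ-≡ 1 _ _ (begin
  sum (dualAt n a) + 1                ≡⟨ cong (sum (dualAt n a) +_) (sum-δ a (λ _ → 1)) ⟨
  sum (dualAt n a) + sum δ₁           ≡⟨ ∑-distrib-+ (dualAt n a) δ₁ ⟨
  sum (λ j → dualAt n a j + δ₁ j)     ≡⟨ sum-cong-≗ pointwise ⟩
  sum (λ j → 1 + δₙ j)                ≡⟨ ∑-distrib-+ (λ _ → 1) δₙ ⟩
  4 + sum δₙ                          ≡⟨ cong (4 +_) (sum-δ a (λ _ → n ∸ 1)) ⟩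
  4 + (n ∸ 1)                         ≡⟨ cong (3 +_) (m+[n∸m]≡n 1≤n) ⟩
  3 + n                               ≡⟨ +-comm 3 n ⟩
  n + 3                               ≡⟨ +-assoc n 2 1 ⟨
  n + 2 + 1                           ∎)
  where
  δ₁ δₙ : Fin 4 → ℕ
  δ₁ j = ind ⌊ a ≟ j ⌋ * 1
  δₙ j = ind ⌊ a ≟ j ⌋ * (n ∸ 1)
  rearrange : ∀ m → m + 1 * 1 ≡ 1 + 1 * m
  rearrange m = solve (m ∷ [])
  pointwise : ∀ j → dualAt n a j + δ₁ j ≡ 1 + δₙ j
  pointwise j with a ≟ j
  ... | yes _ = rearrange (n ∸ 1)
  ... | no _  = refl

-- The parameters (4n, 3n − 2, 3n − 6, 2n − 2) and (4n, n + 2, n − 2, 2)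

private
  3n∸6 : ∀ t → 3 * (2 + t) ∸ 6 ≡ 3 * t
  3n∸6 t = sym (*-distribˡ-∸ 3 (2 + t) 2)

  2n∸2 : ∀ t → 2 * (2 + t) ∸ 2 ≡ 2 + 2 * t
  2n∸2 t = trans (sym (*-distribˡ-∸ 2 (2 + t) 1)) (expand t)
    where
    expand : ∀ t → 2 * (1 + t) ≡ 2 + 2 * t
    expand t = solve (t ∷ [])

  3n∸2 : ∀ t → 3 * (2 + t) ∸ 2 ≡ 4 + 3 * t
  3n∸2 t = cong (_∸ 2) (regroup t)
    where
    regroup : ∀ t → 3 * (2 + t) ≡ 2 + (4 + 3 * t)
    regroup t = solve (t ∷ [])

3n∸6≢2n∸2 : ∀ {n} → 9 ≤ n → 3 * n ∸ 6 ≢ 2 * n ∸ 2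
3n∸6≢2n∸2 {n} 9≤n eq with m≤n⇒∃[o]m+o≡n (≤-trans (s≤s (s≤s z≤n)) 9≤n)
... | t , refl = contradiction 9≤n (subst (λ t → ¬ 9 ≤ 2 + t) (sym t≡2) λ { (s≤s (s≤s (s≤s (s≤s ())))) })
  where
  regroup : ∀ t → t + 2 * t ≡ 3 * t
  regroup t = solve (t ∷ [])
  t≡2 : t ≡ 2
  t≡2 = +-cancelʳ-≡ (2 * t) t 2 (trans (regroup t) (trans (sym (3n∸6 t)) (trans eq (2n∸2 t))))

row-sum-normalised : ∀ {n s} → 1 ≤ n → s ≡ 3 * n ∸ 2 → s + 2 ≡ 3 * n
row-sum-normalised {n} 1≤n refl = m∸n+n≡m (≤-trans (s≤s (s≤s z≤n)) (*-monoʳ-≤ 3 1≤n))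

row-squares-normalised : ∀ {n z} → 2 ≤ n → z + (3 * n ∸ 6) ≡ (3 * n ∸ 6) * n + (3 * n ∸ 2) →
  z + 6 * n ≡ 3 * (n * n) + 4
row-squares-normalised {n} {z} 2≤n eq with m≤n⇒∃[o]m+o≡n 2≤n
... | t , refl = +-cancelʳ-≡ (3 * t) _ _ (begin
  z + 6 * (2 + t) + 3 * t                      ≡⟨ regroup z t ⟩
  z + 3 * t + 6 * (2 + t)                      ≡⟨ cong (_+ 6 * (2 + t)) eq′ ⟩
  3 * t * (2 + t) + (4 + 3 * t) + 6 * (2 + t)  ≡⟨ regroup′ t ⟩
  3 * ((2 + t) * (2 + t)) + 4 + 3 * t          ∎)
  where
  eq′ : z + 3 * t ≡ 3 * t * (2 + t) + (4 + 3 * t)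
  eq′ = trans (cong (z +_) (sym (3n∸6 t))) (trans eq (cong₂ (λ a b → a * (2 + t) + b) (3n∸6 t) (3n∸2 t)))
  regroup : ∀ z t → z + 6 * (2 + t) + 3 * t ≡ z + 3 * t + 6 * (2 + t)
  regroup z t = solve (z ∷ t ∷ [])
  regroup′ : ∀ t → 3 * t * (2 + t) + (4 + 3 * t) + 6 * (2 + t) ≡ 3 * ((2 + t) * (2 + t)) + 4 + 3 * t
  regroup′ t = solve (t ∷ [])

switched-λ₁ : ∀ {n X} → 2 ≤ n → X + (2 * (n ∸ 1) + 2 * (n ∸ 1)) ≡ (3 * n ∸ 6) + 2 * n → X ≡ n ∸ 2
switched-λ₁ {n} {X} 2≤n eq with m≤n⇒∃[o]m+o≡n 2≤n
... | t , refl = +-cancelʳ-≡ (4 + 4 * t) X t (begin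
  X + (4 + 4 * t)                  ≡⟨ regroup X t ⟩
  X + (2 * (1 + t) + 2 * (1 + t))  ≡⟨ eq ⟩
  3 * (2 + t) ∸ 6 + 2 * (2 + t)    ≡⟨ cong (_+ 2 * (2 + t)) (3n∸6 t) ⟩
  3 * t + 2 * (2 + t)              ≡⟨ regroup′ t ⟩
  t + (4 + 4 * t)                  ∎)
  where
  regroup : ∀ X t → X + (4 + 4 * t) ≡ X + (2 * (1 + t) + 2 * (1 + t))
  regroup X t = solve (X ∷ t ∷ [])
  regroup′ : ∀ t → 3 * t + 2 * (2 + t) ≡ t + (4 + 4 * t)
  regroup′ t = solve (t ∷ [])

switched-λ₂-same-half : ∀ {n X} → 2 ≤ n → X + (2 * (n ∸ 1) + 2 * (n ∸ 1)) ≡ (2 * n ∸ 2) + 2 * n → X ≡ 2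
switched-λ₂-same-half {n} {X} 2≤n eq with m≤n⇒∃[o]m+o≡n 2≤n
... | t , refl = +-cancelʳ-≡ (4 + 4 * t) X 2 (begin
  X + (4 + 4 * t)                  ≡⟨ regroup X t ⟩
  X + (2 * (1 + t) + 2 * (1 + t))  ≡⟨ eq ⟩
  2 * (2 + t) ∸ 2 + 2 * (2 + t)    ≡⟨ cong (_+ 2 * (2 + t)) (2n∸2 t) ⟩
  2 + 2 * t + 2 * (2 + t)          ≡⟨ regroup′ t ⟩
  2 + (4 + 4 * t)                  ∎)
  where
  regroup : ∀ X t → X + (4 + 4 * t) ≡ X + (2 * (1 + t) + 2 * (1 + t))
  regroup X t = solve (X ∷ t ∷ [])
  regroup′ : ∀ t → 2 + 2 * t + 2 * (2 + t) ≡ 2 + (4 + 4 * t)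
  regroup′ t = solve (t ∷ [])

switched-λ₂-across : ∀ {n X} → 2 ≤ n → X + (2 * n ∸ 2) ≡ n + n → X ≡ 2
switched-λ₂-across {n} {X} 2≤n eq with m≤n⇒∃[o]m+o≡n 2≤n
... | t , refl = +-cancelʳ-≡ (2 + 2 * t) X 2 (begin
  X + (2 + 2 * t)        ≡⟨ cong (X +_) (2n∸2 t) ⟨
  X + (2 * (2 + t) ∸ 2)  ≡⟨ eq ⟩
  2 + t + (2 + t)        ≡⟨ regroup t ⟩
  2 + (2 + 2 * t)        ∎)
  where
  regroup : ∀ t → 2 + t + (2 + t) ≡ 2 + (2 + 2 * t)
  regroup t = solve (t ∷ [])

-- Switching

switch : ∀ {v} → (Fin v → Bool) → Graph v → Graph v
switch σ K = record
  { adj     = λ x y → (σ x xor σ y) xor adj K x y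
  ; adj-sym = λ x y → cong₂ _xor_ (xor-comm (σ x) (σ y)) (adj-sym K x y)
  ; adj-irr = λ x → trans (cong (_xor adj K x x) (xor-same (σ x))) (adj-irr K x)
  }

switch-involutive : ∀ {v} (σ : Fin v → Bool) (K : Graph v) x y → adj K x y ≡ adj (switch σ (switch σ K)) x y
switch-involutive σ K x y = sym (begin
  s xor (s xor adj K x y)  ≡⟨ xor-assoc s s (adj K x y) ⟨
  (s xor s) xor adj K x y  ≡⟨ cong (_xor adj K x y) (xor-same s) ⟩
  adj K x y                ∎)
  where
  s = σ x xor σ y

on-class : ∀ {v m} (p : Fin v → Fin m) j (F : Fin m → ℕ) w →
  ind ⌊ p w ≟ j ⌋ * F (p w) ≡ ind ⌊ p w ≟ j ⌋ * F j
on-class p j F w with p w ≟ j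
... | yes refl = refl
... | no _     = refl

module Switching {v m n : ℕ} (G : Graph v) (p : Fin v → Fin m) (side : Fin m → Bool)
                 (classSize≡ : ∀ j → sum (λ y → ind ⌊ p y ≟ j ⌋) ≡ n) where

  H : Graph v
  H = switch (side ∘ p) G

  module G = Adjacency G
  module H = Adjacency H
  module Gp = G.Classes p
  module Hp = H.Classes p

  flipped : Fin m → Fin m → Bool
  flipped i j = side i xor side j

  nbrs-switch : ∀ x j → Hp.nbrs x j ≡ (if flipped (p x) j then n ∸ Gp.nbrs x j else Gp.nbrs x j)
  nbrs-switch x j = trans (sum-cong-≗ (λ y → on-class p j (λ i → ind (flipped (p x) i xor adj G x y)) y))
                          (by-flip (flipped (p x) j))
    where
    complement : sum (λ y → ind ⌊ p y ≟ j ⌋ * ind (not (adj G x y))) + Gp.nbrs x j ≡ n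
    complement = begin
      sum (λ y → ind ⌊ p y ≟ j ⌋ * ind (not (adj G x y))) + Gp.nbrs x j
        ≡⟨ ∑-distrib-+ (λ y → ind ⌊ p y ≟ j ⌋ * ind (not (adj G x y)))
                       (λ y → ind ⌊ p y ≟ j ⌋ * G.A x y) ⟨
      sum (λ y → ind ⌊ p y ≟ j ⌋ * ind (not (adj G x y)) + ind ⌊ p y ≟ j ⌋ * G.A x y)
        ≡⟨ sum-cong-≗ (λ y → trans (sym (*-distribˡ-+ (ind ⌊ p y ≟ j ⌋) _ _))
                           (trans (cong (ind ⌊ p y ≟ j ⌋ *_) (ind-not+ind (adj G x y))) (*-identityʳ _))) ⟩
      sum (λ y → ind ⌊ p y ≟ j ⌋)
        ≡⟨ classSize≡ j ⟩
      n ∎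
    by-flip : ∀ s → sum (λ y → ind ⌊ p y ≟ j ⌋ * ind (s xor adj G x y))
                  ≡ (if s then n ∸ Gp.nbrs x j else Gp.nbrs x j)
    by-flip false = refl
    by-flip true  = sym (trans (cong (_∸ Gp.nbrs x j) (sym complement)) (m+n∸n≡m _ (Gp.nbrs x j)))

  common-switch-same : ∀ x y → side (p x) ≡ side (p y) →
    common H x y + sum (λ j → ind (flipped (p x) j) * (Gp.nbrs x j + Gp.nbrs y j))
      ≡ common G x y + sum (λ j → ind (flipped (p x) j) * n)
  common-switch-same x y same = begin
    common H x y + sum (λ j → g j * (Gp.nbrs x j + Gp.nbrs y j))
      ≡⟨ cong₂ _+_ (H.common≡sum x y) (sym (trans (sum-by-class p g (λ w → G.A x w + G.A y w))
                                                  (sum-cong-≗ (λ j → cong (g j *_) (class-pair j))))) ⟩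
    sum (λ w → H.A x w * H.A y w) + sum (λ w → g (p w) * (G.A x w + G.A y w))
      ≡⟨ ∑-distrib-+ (λ w → H.A x w * H.A y w) (λ w → g (p w) * (G.A x w + G.A y w)) ⟨
    sum (λ w → H.A x w * H.A y w + g (p w) * (G.A x w + G.A y w))
      ≡⟨ sum-cong-≗ pointwise ⟩
    sum (λ w → G.A x w * G.A y w + g (p w) * 1)
      ≡⟨ ∑-distrib-+ (λ w → G.A x w * G.A y w) (λ w → g (p w) * 1) ⟩
    sum (λ w → G.A x w * G.A y w) + sum (λ w → g (p w) * 1)
      ≡⟨ cong₂ _+_ (sym (G.common≡sum x y))
                   (trans (sum-by-class p g (λ _ → 1)) (sum-cong-≗ (λ j → cong (g j *_) (class-size j)))) ⟩
    common G x y + sum (λ j → g j * n) ∎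
    where
    g : Fin m → ℕ
    g j = ind (flipped (p x) j)
    class-pair : ∀ j → sum (λ w → ind ⌊ p w ≟ j ⌋ * (G.A x w + G.A y w)) ≡ Gp.nbrs x j + Gp.nbrs y j
    class-pair j = trans (sum-cong-≗ (λ w → *-distribˡ-+ (ind ⌊ p w ≟ j ⌋) (G.A x w) (G.A y w)))
                         (∑-distrib-+ (λ w → ind ⌊ p w ≟ j ⌋ * G.A x w)
                                      (λ w → ind ⌊ p w ≟ j ⌋ * G.A y w))
    class-size : ∀ j → sum (λ w → ind ⌊ p w ≟ j ⌋ * 1) ≡ n
    class-size j = trans (sum-cong-≗ (λ w → *-identityʳ (ind ⌊ p w ≟ j ⌋))) (classSize≡ j)
    ind-switched-same : ∀ f a b → ind (f xor a) * ind (f xor b) + ind f * (ind a + ind b) ≡ ind a * ind b + ind f * 1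
    ind-switched-same true  true  true  = refl
    ind-switched-same true  true  false = refl
    ind-switched-same true  false true  = refl
    ind-switched-same true  false false = refl
    ind-switched-same false a     b     = refl
    pointwise : ∀ w → H.A x w * H.A y w + g (p w) * (G.A x w + G.A y w) ≡ G.A x w * G.A y w + g (p w) * 1
    pointwise w rewrite sym same = ind-switched-same (flipped (p x) (p w)) (adj G x w) (adj G y w)

  common-switch-opposite : ∀ x y → side (p y) ≡ not (side (p x)) →
    common H x y + common G x y
      ≡ sum (λ j → ind (not (flipped (p x) j)) * Gp.nbrs x j) + sum (λ j → ind (not (flipped (p y) j)) * Gp.nbrs y j)
  common-switch-opposite x y opposite = begin
    common H x y + common G x y
      ≡⟨ cong₂ _+_ (H.common≡sum x y) (G.common≡sum x y) ⟩
    sum (λ w → H.A x w * H.A y w) + sum (λ w → G.A x w * G.A y w)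
      ≡⟨ ∑-distrib-+ (λ w → H.A x w * H.A y w) (λ w → G.A x w * G.A y w) ⟨
    sum (λ w → H.A x w * H.A y w + G.A x w * G.A y w)
      ≡⟨ sum-cong-≗ pointwise ⟩
    sum (λ w → gx (p w) * G.A x w + gy (p w) * G.A y w)
      ≡⟨ ∑-distrib-+ (λ w → gx (p w) * G.A x w) (λ w → gy (p w) * G.A y w) ⟩
    sum (λ w → gx (p w) * G.A x w) + sum (λ w → gy (p w) * G.A y w)
      ≡⟨ cong₂ _+_ (sum-by-class p gx (G.A x)) (sum-by-class p gy (G.A y)) ⟩
    sum (λ j → gx j * Gp.nbrs x j) + sum (λ j → gy j * Gp.nbrs y j) ∎
    where
    gx gy : Fin m → ℕ
    gx j = ind (not (flipped (p x) j))
    gy j = ind (not (flipped (p y) j))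
    ind-switched-across : ∀ f a b → ind (f xor a) * ind (not f xor b) + ind a * ind b
                                  ≡ ind (not f) * ind a + ind (not (not f)) * ind b
    ind-switched-across true  true  true  = refl
    ind-switched-across true  true  false = refl
    ind-switched-across true  false true  = refl
    ind-switched-across true  false false = refl
    ind-switched-across false true  true  = refl
    ind-switched-across false true  false = refl
    ind-switched-across false false true  = refl
    ind-switched-across false false false = refl
    flipped-y : ∀ j → flipped (p y) j ≡ not (flipped (p x) j)
    flipped-y j = trans (cong (_xor side j) opposite) (sym (not-distribˡ-xor (side (p x)) (side j)))
    pointwise : ∀ w → H.A x w * H.A y w + G.A x w * G.A y w ≡ gx (p w) * G.A x w + gy (p w) * G.A y w
    pointwise w rewrite flipped-y (p w) = ind-switched-across (flipped (p x) (p w)) (adj G x w) (adj G y w)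

-- Relabelling the classes

spot : Fin 3 → Fin 4 → Fin 4
spot zero                   i                      = i
spot (suc zero)             zero                   = suc zero
spot (suc zero)             (suc zero)             = zero
spot (suc zero)             i                      = i
spot (suc (suc zero))       zero                   = suc zero
spot (suc (suc zero))       (suc zero)             = zero
spot (suc (suc zero))       (suc (suc zero))       = suc (suc (suc zero))
spot (suc (suc zero))       (suc (suc (suc zero))) = suc (suc zero)

Q : Fin 3 → ℕ → Fin 4 → Fin 4 → ℕ
Q zero             = Q1
Q (suc zero)       = Q2
Q (suc (suc zero)) = Q3

tabulated-spots : ∀ s n I J → lookup (lookup (tabulate (λ I → tabulate (dualAt n (spot s I)))) I) J
                                ≡ dualAt n (spot s I) J
tabulated-spots s n I J =
  trans (cong (λ row → lookup row J) (lookup∘tabulate (λ I → tabulate (dualAt n (spot s I))) I))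
        (lookup∘tabulate (dualAt n (spot s I)) J)

-- Q1 n, Q2 n and Q3 n are definitionally the tabulations of dualAt n ∘ spot s.
Q-spot : ∀ s n I J → Q s n I J ≡ dualAt n (spot s I) J
Q-spot zero             = tabulated-spots zero
Q-spot (suc zero)       = tabulated-spots (suc zero)
Q-spot (suc (suc zero)) = tabulated-spots (suc (suc zero))

one-of-three : ∀ {v n} {H : Graph v} {p : Fin v → Fin 4} s → HasQuotient H p (Q s n) →
  HasQuotient H p (Q1 n) ⊎ HasQuotient H p (Q2 n) ⊎ HasQuotient H p (Q3 n)
one-of-three zero             q = inj₁ q
one-of-three (suc zero)       q = inj₂ (inj₁ q)
one-of-three (suc (suc zero)) q = inj₂ (inj₂ q)

half : (Fin 4 → Fin 4) → Fin 4 → Bool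
half π i = inFirstTwo (π i)

-- π numbers the classes of G as the classes W₁, …, W₄ of H, so half π i says whether class i goes to
-- W₁ ∪ W₂; the switching is taken between the two halves.
record Relabelling (c : Fin 4 → Fin 4) : Set where
  field
    π π⁻¹            : Fin 4 → Fin 4
    shape            : Fin 3
    preimage         : ∀ C I → ⌊ π C ≟ I ⌋ ≡ ⌊ C ≟ π⁻¹ I ⌋
    c-same-half      : ∀ i → half π i xor half π (c i) ≡ false
    other-half       : ∀ i → count (λ j → half π i xor half π j) ≡ 2
    same-half        : ∀ i → count (λ j → not (half π i xor half π j)) ≡ 2
    quotient-pattern : ∀ i J →
      ⌊ c i ≟ π⁻¹ J ⌋ xor (half π i xor half π (π⁻¹ J)) ≡ not ⌊ spot shape (π i) ≟ J ⌋

relabelling-cong : ∀ {c c′} → (∀ i → c′ i ≡ c i) → Relabelling c′ → Relabelling c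
relabelling-cong {c} {c′} c′≗c L = record
  { π = π ; π⁻¹ = π⁻¹ ; shape = shape ; preimage = preimage ; other-half = other-half ; same-half = same-half
  ; c-same-half      = λ i → subst (λ a → half π i xor half π a ≡ false) (c′≗c i) (c-same-half i)
  ; quotient-pattern = λ i J → subst (λ a → ⌊ a ≟ π⁻¹ J ⌋ xor (half π i xor half π (π⁻¹ J))
                                              ≡ not ⌊ spot shape (π i) ≟ J ⌋)
                                     (c′≗c i) (quotient-pattern i J)
  }
  where open Relabelling L

table : Fin 4 → Fin 4 → Fin 4 → Fin 4 → Fin 4 → Fin 4
table a b c d zero                   = a
table a b c d (suc zero)             = b
table a b c d (suc (suc zero))       = c
table a b c d (suc (suc (suc zero))) = d

-- The candidate π range over all maps Fin 4 → Fin 4; invert returns junk for a non-injective π, which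
-- then fails the preimage condition.
invert : (Fin 4 → Fin 4) → Fin 4 → Fin 4
invert π I = if ⌊ π zero ≟ I ⌋ then zero else if ⌊ π (suc zero) ≟ I ⌋ then suc zero
             else if ⌊ π (suc (suc zero)) ≟ I ⌋ then suc (suc zero) else suc (suc (suc zero))

candidates : List ((Fin 4 → Fin 4) × Fin 3)
candidates = concatMap (λ a → concatMap (λ b → concatMap (λ c → concatMap (λ d →
  map (table a b c d ,_) (allFin 3)) (allFin 4)) (allFin 4)) (allFin 4)) (allFin 4)

relabelling-by : ∀ c → (Fin 4 → Fin 4) × Fin 3 → Maybe (Relabelling c)
relabelling-by c (π , s)
  with all? (λ C → all? (λ I → ⌊ π C ≟ I ⌋ Bool.≟ ⌊ C ≟ invert π I ⌋))
  ×-dec all? (λ i → (half π i xor half π (c i)) Bool.≟ false)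
  ×-dec all? (λ i → count (λ j → half π i xor half π j) ℕ.≟ 2)
  ×-dec all? (λ i → count (λ j → not (half π i xor half π j)) ℕ.≟ 2)
  ×-dec all? (λ i → all? (λ J → (⌊ c i ≟ invert π J ⌋ xor (half π i xor half π (invert π J)))
                                   Bool.≟ not ⌊ spot s (π i) ≟ J ⌋))
... | yes (p₁ , p₂ , p₃ , p₄ , p₅) =
  just (record { π = π ; π⁻¹ = invert π ; shape = s ; preimage = p₁ ; c-same-half = p₂
               ; other-half = p₃ ; same-half = p₄ ; quotient-pattern = p₅ })
... | no _ = nothing

search : ∀ c → List ((Fin 4 → Fin 4) × Fin 3) → Maybe (Relabelling c)
search c []       = nothing
search c (x ∷ xs) with relabelling-by c x
... | just r  = just r
... | nothing = search c xs

IsInvolution : (Fin 4 → Fin 4) → Set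
IsInvolution c = ∀ i → c (c i) ≡ i

involutions-relabel : ∀ a b c d → IsInvolution (table a b c d) → T (is-just (search (table a b c d) candidates))
involutions-relabel = toWitness {a? = all? λ a → all? λ b → all? λ c → all? λ d →
  all? (λ i → table a b c d (table a b c d i) ≟ i) →-dec T? (is-just (search (table a b c d) candidates))} _

-- Opaque, like quotient-rows below: theorem2 uses both witnesses only through their types, and the
-- with-abstraction there would otherwise normalise this search on a neutral c.
opaque
  relabelling : ∀ c → IsInvolution c → Relabelling c
  relabelling c involution = relabelling-cong table≗c
    (to-witness-T (search c′ candidates)
                  (involutions-relabel (c zero) (c (suc zero)) (c (suc (suc zero))) (c (suc (suc (suc zero))))
                                       (λ i → trans (table≗c (c′ i)) (trans (cong c (table≗c i)) (involution i)))))
    where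
    c′ : Fin 4 → Fin 4
    c′ = table (c zero) (c (suc zero)) (c (suc (suc zero))) (c (suc (suc (suc zero))))
    table≗c : ∀ i → c′ i ≡ c i
    table≗c zero                   = refl
    table≗c (suc zero)             = refl
    table≗c (suc (suc zero))       = refl
    table≗c (suc (suc (suc zero))) = refl

-- The switched graph

flip-oneAt : ∀ {n} → 1 ≤ n → ∀ e f →
  (if f then n ∸ (if e then 1 else n ∸ 1) else (if e then 1 else n ∸ 1)) ≡ (if e xor f then 1 else n ∸ 1)
flip-oneAt 1≤n true  true  = refl
flip-oneAt 1≤n false true  = m∸[m∸n]≡n 1≤n
flip-oneAt 1≤n true  false = refl
flip-oneAt 1≤n false false = refl

if-not : ∀ {A : Set} b (x y : A) → (if not b then x else y) ≡ (if b then y else x)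
if-not true  x y = refl
if-not false x y = refl

module SwitchedDDG {n : ℕ} (9≤n : 9 ≤ n) {G : Graph (4 * n)} {p : Fin (4 * n) → Fin 4}
                   (D : IsDDGPartition {4} {n} G (3 * n ∸ 2) (3 * n ∸ 6) (2 * n ∸ 2) p)
                   {c : Fin 4 → Fin 4} (rows : ∀ x j → DivisibleDesign.nbrs D x j ≡ oneAt n (c (p x)) j)
                   (L : Relabelling c) where

  open Relabelling L
  open IsDDGPartition D using (sameClass; diffClass)
  open DivisibleDesign D using (classSize≡; nbrs)
  open Switching {n = n} G p (half π) classSize≡ public

  1≤n : 1 ≤ n
  1≤n = ≤-trans (s≤s z≤n) 9≤n

  2≤n : 2 ≤ n
  2≤n = ≤-trans (s≤s (s≤s z≤n)) 9≤n

  pH : Fin (4 * n) → Fin 4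
  pH x = π (p x)

  module HpH = H.Classes pH

  π⁻¹∘π : ∀ C → π⁻¹ (π C) ≡ C
  π⁻¹∘π C = sym (⌊≟⌋⇒≡ (trans (sym (preimage C (π C))) (⌊≟⌋-diag (π C))))

  π-injective : ∀ {C C′} → π C ≡ π C′ → C ≡ C′
  π-injective {C} {C′} eq = trans (sym (π⁻¹∘π C)) (trans (cong π⁻¹ eq) (π⁻¹∘π C′))

  H-classSize : ∀ J → count (λ y → ⌊ pH y ≟ J ⌋) ≡ n
  H-classSize J = trans (count≡sum (λ y → ⌊ pH y ≟ J ⌋))
                        (trans (sum-cong-≗ (λ y → cong ind (preimage (p y) J))) (classSize≡ (π⁻¹ J)))

  H-nbrs : ∀ x J → HpH.nbrs x J ≡ dualAt n (spot shape (π (p x))) J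
  H-nbrs x J = begin
    HpH.nbrs x J
      ≡⟨ sum-cong-≗ (λ y → cong (λ b → ind b * H.A x y) (preimage (p y) J)) ⟩
    Hp.nbrs x C
      ≡⟨ nbrs-switch x C ⟩
    (if flipped (p x) C then n ∸ nbrs x C else nbrs x C)
      ≡⟨ cong (λ r → if flipped (p x) C then n ∸ r else r) (rows x C) ⟩
    (if flipped (p x) C then n ∸ oneAt n (c (p x)) C else oneAt n (c (p x)) C)
      ≡⟨ flip-oneAt 1≤n ⌊ c (p x) ≟ C ⌋ (flipped (p x) C) ⟩
    (if ⌊ c (p x) ≟ C ⌋ xor flipped (p x) C then 1 else n ∸ 1)
      ≡⟨ cong (λ b → if b then 1 else n ∸ 1) (quotient-pattern (p x) J) ⟩
    (if not ⌊ spot shape (π (p x)) ≟ J ⌋ then 1 else n ∸ 1)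
      ≡⟨ if-not ⌊ spot shape (π (p x)) ≟ J ⌋ 1 (n ∸ 1) ⟩
    dualAt n (spot shape (π (p x))) J ∎
    where
    C = π⁻¹ J

  H-degree : ∀ x → degree H x ≡ n + 2
  H-degree x = trans (HpH.degree≡∑nbrs x) (trans (sum-cong-≗ (H-nbrs x)) (sum-dualAt 1≤n (spot shape (π (p x)))))

  H-quotient : HasQuotient H pH (Q1 n) ⊎ HasQuotient H pH (Q2 n) ⊎ HasQuotient H pH (Q3 n)
  H-quotient = one-of-three {n = n} {H = H} {p = pH} shape λ x J →
    trans (HpH.nbrsIn≡nbrs x J) (trans (H-nbrs x J) (sym (Q-spot shape n (pH x) J)))

  other-half-sum : ∀ i → sum (λ j → ind (flipped i j) * oneAt n (c i) j) ≡ 2 * (n ∸ 1)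
  other-half-sum i = begin
    S                                                    ≡⟨ +-identityʳ S ⟨
    S + ind false * (n ∸ 1)                              ≡⟨ cong (λ b → S + ind b * (n ∸ 1)) (c-same-half i) ⟨
    S + ind (flipped i (c i)) * (n ∸ 1)                  ≡⟨ sum-oneAt-on n (c i) (flipped i) ⟩
    ind (flipped i (c i)) + count (flipped i) * (n ∸ 1)  ≡⟨ cong₂ (λ b k → ind b + k * (n ∸ 1))
                                                                 (c-same-half i) (other-half i) ⟩
    2 * (n ∸ 1)                                          ∎
    where
    S = sum (λ j → ind (flipped i j) * oneAt n (c i) j)

  same-half-sum : ∀ i → sum (λ j → ind (not (flipped i j)) * oneAt n (c i) j) ≡ n
  same-half-sum i = trans (+-cancelʳ-≡ (n ∸ 1) S (1 + (n ∸ 1)) (begin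
    S + (n ∸ 1)                                ≡⟨ cong (S +_) (*-identityˡ (n ∸ 1)) ⟨
    S + ind true * (n ∸ 1)                     ≡⟨ cong (λ b → S + ind (not b) * (n ∸ 1)) (c-same-half i) ⟨
    S + ind (not (flipped i (c i))) * (n ∸ 1)  ≡⟨ sum-oneAt-on n (c i) (not ∘ flipped i) ⟩
    ind (not (flipped i (c i))) + count (not ∘ flipped i) * (n ∸ 1)
                                               ≡⟨ cong₂ (λ b k → ind (not b) + k * (n ∸ 1))
                                                        (c-same-half i) (same-half i) ⟩
    1 + 2 * (n ∸ 1)                            ≡⟨ regroup (n ∸ 1) ⟩
    1 + (n ∸ 1) + (n ∸ 1)                      ∎)) (m+[n∸m]≡n 1≤n)
    where
    S = sum (λ j → ind (not (flipped i j)) * oneAt n (c i) j)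
    regroup : ∀ m → 1 + 2 * m ≡ 1 + m + m
    regroup m = solve (m ∷ [])

  other-half-size : ∀ i → sum (λ j → ind (flipped i j) * n) ≡ 2 * n
  other-half-size i = trans (sym (*-distribʳ-sum n (ind ∘ flipped i)))
                            (cong (_* n) (trans (sym (count≡sum (flipped i))) (other-half i)))

  rows-on : ∀ x (b : Fin 4 → Bool) →
    sum (λ j → ind (b j) * nbrs x j) ≡ sum (λ j → ind (b j) * oneAt n (c (p x)) j)
  rows-on x b = sum-cong-≗ (λ j → cong (ind (b j) *_) (rows x j))

  common-same-half : ∀ x y → half π (p x) ≡ half π (p y) →
    common H x y + (2 * (n ∸ 1) + 2 * (n ∸ 1)) ≡ common G x y + 2 * n
  common-same-half x y same = begin
    common H x y + (2 * (n ∸ 1) + 2 * (n ∸ 1))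
      ≡⟨ cong (common H x y +_) (cong₂ _+_ (trans (rows-on x (flipped (p x))) (other-half-sum (p x)))
                                           (trans (rows-on y (flipped (p x))) y-side)) ⟨
    common H x y + (sum (λ j → g j * nbrs x j) + sum (λ j → g j * nbrs y j))
      ≡⟨ cong (common H x y +_) (trans (sum-cong-≗ (λ j → *-distribˡ-+ (g j) (nbrs x j) (nbrs y j)))
                                       (∑-distrib-+ (λ j → g j * nbrs x j) (λ j → g j * nbrs y j))) ⟨
    common H x y + sum (λ j → g j * (nbrs x j + nbrs y j))
      ≡⟨ common-switch-same x y same ⟩
    common G x y + sum (λ j → g j * n)
      ≡⟨ cong (common G x y +_) (other-half-size (p x)) ⟩
    common G x y + 2 * n ∎
    where
    g : Fin 4 → ℕ
    g j = ind (flipped (p x) j)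
    y-side : sum (λ j → g j * oneAt n (c (p y)) j) ≡ 2 * (n ∸ 1)
    y-side = trans (sum-cong-≗ (λ j → cong (λ s → ind (s xor half π j) * oneAt n (c (p y)) j) same))
                   (other-half-sum (p y))

  H-same-class : ∀ x y → x ≢ y → pH x ≡ pH y → common H x y ≡ n ∸ 2
  H-same-class x y x≢y eq = switched-λ₁ 2≤n
    (trans (common-same-half x y (cong (half π) pxy)) (cong (_+ 2 * n) (sameClass x y x≢y pxy)))
    where
    pxy : p x ≡ p y
    pxy = π-injective eq

  H-diff-class : ∀ x y → pH x ≢ pH y → common H x y ≡ 2
  H-diff-class x y ne with half π (p x) Bool.≟ half π (p y)
  ... | yes same = switched-λ₂-same-half 2≤n
    (trans (common-same-half x y same) (cong (_+ 2 * n) (diffClass x y (ne ∘ cong π))))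
  ... | no differ = switched-λ₂-across 2≤n (begin
    common H x y + (2 * n ∸ 2)
      ≡⟨ cong (common H x y +_) (diffClass x y (ne ∘ cong π)) ⟨
    common H x y + common G x y
      ≡⟨ common-switch-opposite x y (Bool.¬-not (differ ∘ sym)) ⟩
    sum (λ j → ind (not (flipped (p x) j)) * nbrs x j) + sum (λ j → ind (not (flipped (p y) j)) * nbrs y j)
      ≡⟨ cong₂ _+_ (trans (rows-on x (not ∘ flipped (p x))) (same-half-sum (p x)))
                   (trans (rows-on y (not ∘ flipped (p y))) (same-half-sum (p y))) ⟩
    n + n ∎)

  H-DDG : IsDDGPartition {4} {n} H (n + 2) (n ∸ 2) 2 pH
  H-DDG = record { classSize = H-classSize ; regular = H-degree ; sameClass = H-same-class ; diffClass = H-diff-class }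

  G≅switched : IsoToAdj G (switchAdj H pH)
  G≅switched = ↔-id _ , switch-involutive (half π ∘ p) G

opaque
  quotient-rows : ∀ {n} → 9 ≤ n → {G : Graph (4 * n)} {p : Fin (4 * n) → Fin 4} →
    (D : IsDDGPartition {4} {n} G (3 * n ∸ 2) (3 * n ∸ 6) (2 * n ∸ 2) p) →
    ∃ λ c → IsInvolution c × ∀ x j → DivisibleDesign.nbrs D x j ≡ oneAt n (c (p x)) j
  quotient-rows {n} 9≤n {p = p} D = c , involution , λ x j → trans (nbrs≡R x j) (proj₂ (row (p x)) j)
    where
    open DivisibleDesign D
    open QuotientMatrix D (3n∸6≢2n∸2 9≤n) (≤-trans (s≤s z≤n) 9≤n)
    row : ∀ i → ∃ λ a → ∀ j → R i j ≡ oneAt n a j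
    row i = row-shape 9≤n (R i) (nbrs≤n (rep i))
      (row-sum-normalised (≤-trans (s≤s z≤n) 9≤n) (∑nbrs (rep i)))
      (row-squares-normalised (≤-trans (s≤s (s≤s z≤n)) 9≤n) (∑nbrs² (3n∸6≢2n∸2 9≤n) (rep i)))
    c : Fin 4 → Fin 4
    c i = proj₁ (row i)
    involution : IsInvolution c
    involution i = oneAt≡1 (≤-trans (s≤s (s≤s (s≤s z≤n))) 9≤n) (c (c i)) i (begin
      oneAt n (c (c i)) i  ≡⟨ proj₂ (row (c i)) i ⟨
      R (c i) i            ≡⟨ R-sym (c i) i ⟩
      R i (c i)            ≡⟨ proj₂ (row i) (c i) ⟩
      oneAt n (c i) (c i)  ≡⟨ cong (λ b → if b then 1 else n ∸ 1) (⌊≟⌋-diag (c i)) ⟩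
      1                    ∎)

theorem2 : (n : ℕ) → 8 < n → (G : Graph (4 * n)) →
    IsDDG {4} {n} G (3 * n ∸ 2) (3 * n ∸ 6) (2 * n ∸ 2) →
    Σ (Graph (4 * n)) (λ H → Σ (Fin (4 * n) → Fin 4) (λ p →
      IsDDGPartition {4} {n} H (n + 2) (n ∸ 2) 2 p
      × (HasQuotient H p (Q1 n) ⊎ HasQuotient H p (Q2 n) ⊎ HasQuotient H p (Q3 n))
      × IsoToAdj G (switchAdj H p)))
theorem2 n 9≤n G (p , D) with quotient-rows 9≤n D
... | c , involution , rows with relabelling c involution
...   | L = H , pH , H-DDG , H-quotient , G≅switched
  where open SwitchedDDG 9≤n D rows L
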